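{- Let $(N,R),(N,G)$ be a pair of directed graphs with property $P_2$, and let $(N,*)$ be its associated groupoid ($a*b$ is the unique $c$ with $(a,c)\in R$, $(c,b)\in G$). The following are equivalent: (1) $R$ is an equivalence relation on $N$ (i.e. $(N,R)$ is a disjoint union of cliques, with a loop at every node) and $(a,a)\in G$ for every $a\in N$; (2) the graph pair $(N,R),(N,G)$ is partitioned; (3) $(N,*)$ satisfies $a*a=a$ and $(a*b)*c=a*c$ for all $a,b,c\in N$.
   Context: Graphs are directed graphs with edge sets subsets of $N\times N$ (loops allowed). A pair of graphs $(N,R),(N,G)$ has property $P_2$ if for every $a,b\in N$ there exists a unique $c\in N$ with $(a,c)\in R$ and $(c,b)\in G$. The graph pair is called partitioned if there exist a partition $\Pi$ of $N$ and, for each part $\pi\in\Pi$, a partition $\theta_\pi$ of $N$ such that $\pi$ is a transversal of $\theta_\pi$ (meets every block of $\theta_\pi$ in exactly one element), with $R=\{(a,b): a,b \text{ lie in the same part of }\Pi\}$ and $G=\{(a,b): a\in\pi\in\Pi \text{ and } a,b \text{ lie in the same block of } \theta_\pi\}$. -}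

module Defs where

open import Level using (0ℓ)
open import Data.Product using (Σ; ∃; ∃!; _×_; proj₁)
open import Relation.Binary.Core using (Rel)
open import Relation.Binary.Structures using (IsEquivalence)
open import Relation.Binary.PropositionalEquality using (_≡_)
open import Relation.Unary using (Pred; _∈_; _≐_)
open import Function.Bundles using (_⇔_)

Subset : Set → Set₁
Subset N = Pred N 0ℓ

Family : Set → Set₁
Family N = Pred (Subset N) 0ℓ

record IsPartition {N : Set} (Π : Family N) : Set₁ where
  field
    nonempty : ∀ π → π ∈ Π → ∃ λ a → a ∈ π
    covers   : ∀ a → ∃ λ π → π ∈ Π × a ∈ π
    disjoint : ∀ π π′ → π ∈ Π → π′ ∈ Π → (∃ λ a → a ∈ π × a ∈ π′) → π ≐ π′

IsTransversal : {N : Set} → Subset N → Family N → Set₁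
IsTransversal π θ = ∀ β → β ∈ θ → ∃! _≡_ (λ a → a ∈ π × a ∈ β)

P₂ : {N : Set} → Rel N 0ℓ → Rel N 0ℓ → Set
P₂ {N} R G = ∀ (a b : N) → ∃! _≡_ (λ c → R a c × G c b)

groupoidOp : {N : Set} {R G : Rel N 0ℓ} → P₂ R G → N → N → N
groupoidOp p a b = proj₁ (p a b)

record Partitioned {N : Set} (R G : Rel N 0ℓ) : Set₁ where
  field
    Π          : Family N
    θ          : Subset N → Family N
    Π-part     : IsPartition Π
    θ-part     : ∀ π → π ∈ Π → IsPartition (θ π)
    θ-transv   : ∀ π → π ∈ Π → IsTransversal π (θ π)
    R-def      : ∀ a b → R a b ⇔ (∃ λ π → π ∈ Π × a ∈ π × b ∈ π)
    G-def      : ∀ a b → G a b ⇔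
                   (∃ λ π → π ∈ Π × a ∈ π × (∃ λ β → β ∈ θ π × a ∈ β × b ∈ β))

Cond1 : {N : Set} → Rel N 0ℓ → Rel N 0ℓ → Set
Cond1 R G = IsEquivalence R × (∀ a → G a a)

Cond3 : {N : Set} {R G : Rel N 0ℓ} → P₂ R G → Set
Cond3 {N} p = (∀ (a : N) → a * a ≡ a) × (∀ (a b c : N) → (a * b) * c ≡ a * c)
  where
    _*_ : N → N → N
    _*_ = groupoidOp p

-- The key P₂ fact is that inside one R-class the G-predecessors of a point
--   are unique; it gives disjointness of θ π and that π is a transversal.
-- * (1) ⇔ (3) is algebra of the operation: R a c holds iff a * c = c
--   (when G is reflexive), and (1), (3) translate into each other by this.
module Submission where

open import Defs
open import Level using (Level; 0ℓ; suc)
open import Data.Product using (_×_; _,_; proj₁; proj₂; ∃)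
open import Data.Unit using (tt)
open import Relation.Binary.Core using (Rel)
open import Relation.Binary.Structures using (IsEquivalence)
open import Relation.Binary.PropositionalEquality using (_≡_; subst; cong)
import Relation.Binary.PropositionalEquality as ≡
open import Relation.Unary using (U; _∈_; _⊆_; _≐_)
open import Relation.Unary.Properties using (≐-refl)
open import Function.Base using (_∘_)
open import Function.Bundles using (_⇔_; mk⇔; Equivalence)

module _ {N : Set} where

  SameBlock : Family N → Rel N (suc 0ℓ)
  SameBlock Π a b = ∃ λ π → π ∈ Π × a ∈ π × b ∈ π

  sameBlock-isEquivalence : {Π : Family N} → IsPartition Π → IsEquivalence (SameBlock Π)
  sameBlock-isEquivalence part = record
    { refl  = λ {a} → let (π , πΠ , aπ) = covers a in π , πΠ , aπ , aπ
    ; sym   = λ (π , πΠ , aπ , bπ) → π , πΠ , bπ , aπ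
    ; trans = λ (π , πΠ , aπ , bπ) (π′ , π′Π , bπ′ , cπ′) →
                π , πΠ , aπ , proj₂ (disjoint π π′ πΠ π′Π (_ , bπ , bπ′)) cπ′
    }
    where open IsPartition part

  isEquivalence-⇔ : {ℓ ℓ′ : Level} {R : Rel N ℓ} {S : Rel N ℓ′} →
                    (∀ a b → R a b ⇔ S a b) → IsEquivalence S → IsEquivalence R
  isEquivalence-⇔ {R = R} {S = S} R⇔S eqS = record
    { refl  = from (IsEquivalence.refl eqS)
    ; sym   = from ∘ IsEquivalence.sym eqS ∘ to
    ; trans = λ r s → from (IsEquivalence.trans eqS (to r) (to s))
    }
    where
    to : ∀ {a b} → R a b → S a b
    to {a} {b} = Equivalence.to (R⇔S a b)
    from : ∀ {a b} → S a b → R a b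
    from {a} {b} = Equivalence.from (R⇔S a b)

  Fibres : (N → Subset N) → Subset N → Family N
  Fibres F S β = ∃ λ c → c ∈ S × β ≐ F c

  fibres-partition : {F : N → Subset N} {S : Subset N} →
    (∀ {c} → c ∈ S → c ∈ F c) →
    (∀ b → ∃ λ c → c ∈ S × b ∈ F c) →
    (∀ {c c′ b} → c ∈ S → c′ ∈ S → b ∈ F c → b ∈ F c′ → F c ⊆ F c′) →
    IsPartition (Fibres F S)
  fibres-partition {F} self cover nested = record
    { nonempty = λ { β (c , cS , _ , F⊆β) → c , F⊆β (self cS) }
    ; covers   = λ b → let (c , cS , bF) = cover b in
                   F c , (c , cS , ≐-refl) , bF
    ; disjoint = λ { β β′ (c , cS , β⊆ , ⊆β) (c′ , c′S , β′⊆ , ⊆β′) (b , bβ , bβ′) →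
                   (λ x → ⊆β′ (nested cS c′S (β⊆ bβ) (β′⊆ bβ′) (β⊆ x)))
                 , (λ x → ⊆β (nested c′S cS (β′⊆ bβ′) (β⊆ bβ) (β′⊆ x))) }
    }

partitioned⇒cond1 : {N : Set} {R G : Rel N 0ℓ} → Partitioned R G → Cond1 R G
partitioned⇒cond1 {G = G} P =
  isEquivalence-⇔ R-def (sameBlock-isEquivalence Π-part) , G-refl
  where
  open Partitioned P
  G-refl : ∀ a → G a a
  G-refl a =
    let (π , πΠ , aπ) = IsPartition.covers Π-part a
        (β , βθ , aβ) = IsPartition.covers (θ-part π πΠ) a
    in Equivalence.from (G-def a a) (π , πΠ , aπ , β , βθ , aβ , aβ)

module _ {N : Set} {R G : Rel N 0ℓ} (p : P₂ R G) where

  _*_ : N → N → N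
  _*_ = groupoidOp p

  R-* : ∀ a b → R a (a * b)
  R-* a b = proj₁ (proj₁ (proj₂ (p a b)))

  G-* : ∀ a b → G (a * b) b
  G-* a b = proj₂ (proj₁ (proj₂ (p a b)))

  *-unique : ∀ {a b c} → R a c → G c b → a * b ≡ c
  *-unique r g = proj₂ (proj₂ (p _ _)) (r , g)

  G-pred-unique : ∀ {x c d b} → R x c → R x d → G c b → G d b → c ≡ d
  G-pred-unique rc rd gc gd = ≡.trans (≡.sym (*-unique rc gc)) (*-unique rd gd)

  R⇔absorbs : (∀ c → G c c) → ∀ {a c} → R a c ⇔ (a * c ≡ c)
  R⇔absorbs G-refl {a} {c} =
    mk⇔ (λ r → *-unique r (G-refl c)) (λ e → subst (R a) e (R-* a c))

  cond1⇒cond3 : Cond1 R G → Cond3 p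
  cond1⇒cond3 (R-eq , G-refl) = idem , absorb
    where
    open IsEquivalence R-eq
    idem : ∀ a → a * a ≡ a
    idem a = Equivalence.to (R⇔absorbs G-refl) refl
    -- (a * b) * c is an R-successor of a and a G-predecessor of c.
    absorb : ∀ a b c → (a * b) * c ≡ a * c
    absorb a b c = ≡.sym (*-unique (trans (R-* a b) (R-* (a * b) c)) (G-* (a * b) c))

  cond3⇒cond1 : Cond3 p → Cond1 R G
  cond3⇒cond1 (idem , absorb) = record { refl = R-refl ; sym = R-sym ; trans = R-trans } , G-refl
    where
    open ≡.≡-Reasoning
    G-refl : ∀ a → G a a
    G-refl a = subst (λ x → G x a) (idem a) (G-* a a)
    absorbs : ∀ {a c} → R a c → a * c ≡ c
    absorbs = Equivalence.to (R⇔absorbs G-refl)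
    absorbed : ∀ {a c} → a * c ≡ c → R a c
    absorbed = Equivalence.from (R⇔absorbs G-refl)
    R-refl : ∀ {a} → R a a
    R-refl {a} = absorbed (idem a)
    R-sym : ∀ {a b} → R a b → R b a
    R-sym {a} {b} r = absorbed (begin
      b * a        ≡⟨ cong (_* a) (absorbs r) ⟨
      (a * b) * a  ≡⟨ absorb a b a ⟩
      a * a        ≡⟨ idem a ⟩
      a            ∎)
    R-trans : ∀ {a b c} → R a b → R b c → R a c
    R-trans {a} {b} {c} r s = absorbed (begin
      a * c        ≡⟨ absorb a b c ⟨
      (a * b) * c  ≡⟨ cong (_* c) (absorbs r) ⟩
      b * c        ≡⟨ absorbs s ⟩
      c            ∎)

  -- (1) ⇒ (2): Π consists of the R-classes R x, and θ π of the sets G c, c ∈ π.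
  cond1⇒partitioned : Cond1 R G → Partitioned R G
  cond1⇒partitioned (R-eq , G-refl) = record
    { Π = Π ; θ = θ ; Π-part = Π-part ; θ-part = θ-part ; θ-transv = θ-transv
    ; R-def = λ a b → mk⇔ (λ r → R a , class a , refl , r)
                          (λ (π , (_ , _ , π⊆ , _) , aπ , bπ) → trans (sym (π⊆ aπ)) (π⊆ bπ))
    ; G-def = λ a b → mk⇔ (λ g → R a , class a , refl , G a , (a , refl , ≐-refl) , G-refl a , g)
                          (λ (π , (_ , _ , π⊆ , _) , aπ , β , (c , cπ , β⊆ , _) , aβ , bβ) →
                             subst (λ y → G y b) (pred-unique π⊆ cπ aπ (β⊆ aβ)) (β⊆ bβ))
    }
    where
    open IsEquivalence R-eq
    Π : Family N
    Π = Fibres R U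
    θ : Subset N → Family N
    θ π = Fibres G π
    class : ∀ x → R x ∈ Π
    class x = x , tt , ≐-refl
    pred-unique : ∀ {π x c a} → π ⊆ R x → c ∈ π → a ∈ π → G c a → c ≡ a
    pred-unique π⊆ cπ aπ g = G-pred-unique (π⊆ cπ) (π⊆ aπ) g (G-refl _)
    Π-part : IsPartition Π
    Π-part = fibres-partition (λ _ → refl) (λ b → b , tt , refl)
                              (λ _ _ r r′ s → trans (trans r′ (sym r)) s)
    -- Inside the class π of x, b lies in G (x * b); overlapping G c, G c′ have c = c′.
    θ-part : ∀ π → π ∈ Π → IsPartition (θ π)
    θ-part π (x , _ , π⊆ , ⊆π) = fibres-partition (λ _ → G-refl _)
      (λ b → x * b , ⊆π (R-* x b) , G-* x b)
      (λ cπ c′π g g′ → subst (λ c → G c _) (G-pred-unique (π⊆ cπ) (π⊆ c′π) g g′))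
    -- The only point of π in the block G c is c itself.
    θ-transv : ∀ π → π ∈ Π → IsTransversal π (θ π)
    θ-transv π (_ , _ , π⊆ , _) β (c , cπ , β⊆ , ⊆β) =
      c , (cπ , ⊆β (G-refl c)) , λ (dπ , dβ) → pred-unique π⊆ cπ dπ (β⊆ dβ)

mainTheorem10 : {N : Set} (R G : Rel N 0ℓ) (p : P₂ R G) →
    (Cond1 R G ⇔ Partitioned R G) × (Partitioned R G ⇔ Cond3 p)
mainTheorem10 R G p =
    mk⇔ (cond1⇒partitioned p) partitioned⇒cond1
  , mk⇔ (cond1⇒cond3 p ∘ partitioned⇒cond1) (cond1⇒partitioned p ∘ cond3⇒cond1 p)
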